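{- Let $m\ge 1$ be an integer and let $D$ be a $2$-strong digraph of order $n=2m+1\geq 3$. Then any two $T$-vertices $x$ and $y$ of $D$ lie on a common (directed) cycle of $D$.
   Context: Digraphs are finite, without loops and without multiple arcs (a pair of opposite arcs $xy$, $yx$ is allowed). For a vertex $x$, $d^+(x)$ and $d^-(x)$ denote its out-degree and in-degree. A digraph $D$ is strong if for every ordered pair of distinct vertices $u,v$ there is a directed path from $u$ to $v$; it is $k$-strong if $|V(D)|\ge k+1$ and deleting any set of fewer than $k$ vertices leaves a strong digraph. For a digraph $D$ of order $n=2m+1$, a $T$-vertex is a vertex $x$ with $d^+(x)\ge m$ and $d^-(x)\ge m$. -}

module Defs where

open import Data.Nat using (ℕ; suc; _+_; _*_; _<_; _≤_)
open import Data.Bool using (Bool; true; false; if_then_else_)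
open import Data.Fin using (Fin)
open import Data.Fin.Subset using (Subset; _∉_; ∣_∣)
open import Data.List using (List; []; _∷_; _∷ʳ_; _++_; map; allFin)
open import Data.Nat.ListAction using (sum)
open import Data.Empty using (⊥)
open import Data.List.Relation.Unary.All using (All)
open import Data.List.Relation.Unary.Linked using (Linked)
open import Data.List.Relation.Unary.Unique.Propositional using (Unique)
open import Data.List.Membership.Propositional using (_∈_)
open import Data.Product using (Σ; _×_)
open import Relation.Binary.PropositionalEquality using (_≡_; _≢_)

-- A digraph on vertex set Fin n: adjacency given by a Boolean relation,
-- without loops (multiple arcs impossible; opposite arcs allowed).
record Digraph (n : ℕ) : Set where
  field
    adj      : Fin n → Fin n → Bool
    loopless : ∀ x → adj x x ≡ false

module _ {n : ℕ} (D : Digraph n) where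
  open Digraph D

  Arc : Fin n → Fin n → Set
  Arc x y = adj x y ≡ true

  indicator : Bool → ℕ
  indicator b = if b then 1 else 0

  outdeg : Fin n → ℕ
  outdeg x = sum (map (λ y → indicator (adj x y)) (allFin n))

  indeg : Fin n → ℕ
  indeg x = sum (map (λ y → indicator (adj y x)) (allFin n))

  PathAvoiding : Subset n → Fin n → Fin n → Set
  PathAvoiding S u v =
    Σ (List (Fin n)) λ mid →
      Unique (u ∷ mid ∷ʳ v) × Linked Arc (u ∷ mid ∷ʳ v) × All (λ w → w ∉ S) (u ∷ mid ∷ʳ v)

  StrongAvoiding : Subset n → Set
  StrongAvoiding S = ∀ u v → u ∉ S → v ∉ S → u ≢ v → PathAvoiding S u v

  KStrong : ℕ → Set
  KStrong k = (k + 1 ≤ n) × (∀ (S : Subset n) → ∣ S ∣ < k → StrongAvoiding S)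

  IsCycle : List (Fin n) → Set
  IsCycle [] = ⊥
  IsCycle (c ∷ rest) = Unique (c ∷ rest) × Linked Arc ((c ∷ rest) ∷ʳ c)

  CommonCycle : Fin n → Fin n → Set
  CommonCycle x y = Σ (List (Fin n)) λ C → IsCycle C × x ∈ C × y ∈ C

  TVertex : ℕ → Fin n → Set
  TVertex m x = (m ≤ outdeg x) × (m ≤ indeg x)

-- If x → y is an arc, close it with a path y ⇝ x, which exists since D is strong.
-- If x → z → y for some z, close it with a path y ⇝ x in D - z, which exists
-- since D is 2-strong.  Otherwise the out-neighbours of x, the in-neighbours
-- of y, x and y are pairwise distinct vertices, so d⁺(x) + d⁻(y) + 2 ≤ 2m + 1,
-- contradicting d⁺(x), d⁻(y) ≥ m.
module Submission where

open import Defs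
open import Data.Nat using (ℕ; _≤_; _<_; _+_; _*_; z≤n; s≤s)
open import Data.Nat.Properties
  using (≤-refl; ≤-trans; +-assoc; +-identityʳ; +-mono-≤; +-monoˡ-≤; +-monoʳ-≤; +-cancelˡ-≤;
         m≤m+n; m≤n+m; +-commutativeSemigroup)
open import Algebra.Properties.CommutativeSemigroup +-commutativeSemigroup using (interchange)
open import Data.Nat.ListAction using (sum)
open import Data.Bool using (true; false)
import Data.Bool.Properties as Bool
open import Data.Fin using (Fin; _≟_)
open import Data.Fin.Subset using (⊥; ⁅_⁆; _∈_; _∉_)
open import Data.Fin.Subset.Properties using (∉⊥; ∣⊥∣≡0; ∣⁅x⁆∣≡1; x∈⁅x⁆; x∈⁅y⁆⇒x≡y)
open import Data.Fin.Properties using (any?)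
open import Data.List using (List; []; _∷_; _∷ʳ_; map; allFin; length)
open import Data.List.Properties using (length-tabulate)
open import Data.List.Relation.Unary.All as All using ([]; _∷_)
open import Data.List.Relation.Unary.All.Properties using (++⁻ˡ; ++⁻ʳ)
open import Data.List.Relation.Unary.AllPairs using ([]; _∷_)
open import Data.List.Relation.Unary.Linked using (_∷_)
open import Data.List.Relation.Unary.Unique.Propositional using (Unique)
open import Data.List.Relation.Unary.Any using (here; there)
import Data.List.Membership.Propositional as List
open import Data.List.Membership.Propositional.Properties using (∈-allFin)
open import Data.Product using (_×_; _,_; proj₁)
open import Data.Empty using (⊥-elim)
open import Relation.Nullary using (Dec; yes; no; does; ¬_)
open import Relation.Nullary.Decidable using (_×-dec_; dec-true)
open import Relation.Binary.PropositionalEquality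

m+m+2≰2*m+1 : ∀ m → ¬ (m + m + 2 ≤ 2 * m + 1)
m+m+2≰2*m+1 m m+m+2≤2m+1
  with s≤s () ← +-cancelˡ-≤ (m + m) 2 1
                  (subst (m + m + 2 ≤_) (cong (λ k → m + k + 1) (+-identityʳ m)) m+m+2≤2m+1)

sum-map-+ : ∀ {A : Set} (f g : A → ℕ) (xs : List A) →
  sum (map (λ a → f a + g a) xs) ≡ sum (map f xs) + sum (map g xs)
sum-map-+ f g [] = refl
sum-map-+ f g (x ∷ xs) = begin
  f x + g x + sum (map (λ a → f a + g a) xs)  ≡⟨ cong (f x + g x +_) (sum-map-+ f g xs) ⟩
  f x + g x + (sum (map f xs) + sum (map g xs)) ≡⟨ interchange (f x) (g x) _ _ ⟩
  f x + sum (map f xs) + (g x + sum (map g xs)) ∎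
  where open ≡-Reasoning

sum-map≤length : ∀ {A : Set} (f : A → ℕ) (xs : List A) → (∀ a → f a ≤ 1) →
  sum (map f xs) ≤ length xs
sum-map≤length f [] f≤1 = z≤n
sum-map≤length f (x ∷ xs) f≤1 = +-mono-≤ (f≤1 x) (sum-map≤length f xs f≤1)

∈⇒≤sum-map : ∀ {A : Set} (f : A → ℕ) {x} (xs : List A) → x List.∈ xs → f x ≤ sum (map f xs)
∈⇒≤sum-map f (x ∷ xs) (here refl) = m≤m+n (f x) _
∈⇒≤sum-map f (x ∷ xs) (there x∈xs) = ≤-trans (∈⇒≤sum-map f xs x∈xs) (m≤n+m _ (f x))

Unique-∷ʳ⇒Unique-∷ : ∀ {A : Set} {v : A} xs → Unique (xs ∷ʳ v) → Unique (v ∷ xs)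
Unique-∷ʳ⇒Unique-∷ [] _ = [] ∷ []
Unique-∷ʳ⇒Unique-∷ (x ∷ xs) (x∉xs∷ʳv ∷ uniq) with Unique-∷ʳ⇒Unique-∷ xs uniq
... | v∉xs ∷ uniq-xs =
  (≢-sym (All.head (++⁻ʳ xs x∉xs∷ʳv)) ∷ v∉xs) ∷ (++⁻ˡ xs x∉xs∷ʳv ∷ uniq-xs)

module _ {n : ℕ} (D : Digraph n) where
  open Digraph D

  Arc? : ∀ u v → Dec (Arc D u v)
  Arc? u v = adj u v Bool.≟ true

  Arc⇒≢ : ∀ {u v} → Arc D u v → u ≢ v
  Arc⇒≢ {u} uv refl with () ← trans (sym uv) (loopless u)

  path+arc⇒cycle : ∀ {S u v} (P : PathAvoiding D S u v) → Arc D v u → IsCycle D (v ∷ u ∷ proj₁ P)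
  path+arc⇒cycle {u = u} (mid , uniq , linked , _) vu = Unique-∷ʳ⇒Unique-∷ (u ∷ mid) uniq , vu ∷ linked

  arc+path⇒path : ∀ {S z u v} → z ∈ S → Arc D z u → (P : PathAvoiding D S u v) →
    PathAvoiding D ⊥ z v
  arc+path⇒path {S} {z} {u} z∈S zu (mid , uniq , linked , avoids) =
    u ∷ mid , All.map z≢ avoids ∷ uniq , zu ∷ linked , All.universal (λ _ → ∉⊥) _
    where
    z≢ : ∀ {w} → w ∉ S → z ≢ w
    z≢ w∉S refl = w∉S z∈S

  no-short-path⇒outdeg+indeg+2≤n : ∀ {x y} → x ≢ y → ¬ Arc D x y →
    (∀ z → ¬ (Arc D x z × Arc D z y)) → outdeg D x + indeg D y + 2 ≤ n
  no-short-path⇒outdeg+indeg+2≤n {x} {y} x≢y ¬xy ¬xzy = begin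
    outdeg D x + indeg D y + 2                            ≡⟨ +-assoc _ 1 1 ⟨
    outdeg D x + indeg D y + 1 + 1                        ≤⟨ +-mono-≤ (+-monoʳ-≤ _ (1≤Σeq x)) (1≤Σeq y) ⟩
    outdeg D x + indeg D y + Σeq x + Σeq y                ≡⟨ cong (λ s → s + Σeq x + Σeq y) (sum-map-+ out in′ L) ⟨
    sum (map (λ z → out z + in′ z) L) + Σeq x + Σeq y     ≡⟨ cong (_+ Σeq y) (sum-map-+ _ (eq x) L) ⟨
    sum (map (λ z → out z + in′ z + eq x z) L) + Σeq y    ≡⟨ sum-map-+ _ (eq y) L ⟨
    sum (map count L)                                     ≤⟨ sum-map≤length count L count≤1 ⟩
    length L                                              ≡⟨ length-tabulate (λ i → i) ⟩
    n                                                     ∎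
    where
    open Data.Nat.Properties.≤-Reasoning
    L : List (Fin n)
    L = allFin n
    out in′ : Fin n → ℕ
    out z = indicator D (adj x z)
    in′ z = indicator D (adj z y)
    eq : Fin n → Fin n → ℕ
    eq w z = indicator D (does (z ≟ w))
    Σeq : Fin n → ℕ
    Σeq w = sum (map (eq w) L)
    count : Fin n → ℕ
    count z = out z + in′ z + eq x z + eq y z
    1≤Σeq : ∀ w → 1 ≤ Σeq w
    1≤Σeq w = subst (_≤ Σeq w) (cong (indicator D) (dec-true (w ≟ w) refl))
                    (∈⇒≤sum-map (eq w) L (∈-allFin w))
    count≤1 : ∀ z → count z ≤ 1
    count≤1 z with z ≟ x | z ≟ y
    ... | yes refl | yes refl = ⊥-elim (x≢y refl)
    ... | yes refl | no _ rewrite loopless x | Bool.¬-not ¬xy = ≤-refl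
    ... | no _ | yes refl rewrite loopless y | Bool.¬-not ¬xy = ≤-refl
    ... | no _ | no _ with adj x z in xz | adj z y in zy
    ...   | true  | true  = ⊥-elim (¬xzy z (xz , zy))
    ...   | true  | false = ≤-refl
    ...   | false | true  = ≤-refl
    ...   | false | false = z≤n

theorem1 : (m : ℕ) → 1 ≤ m → (D : Digraph (2 * m + 1)) → KStrong D 2 →
    (x y : Fin (2 * m + 1)) → x ≢ y → TVertex D m x → TVertex D m y →
    CommonCycle D x y
theorem1 m _ D (_ , strong) x y x≢y (m≤outdeg , _) (_ , m≤indeg)
  with Arc? D x y | any? (λ z → Arc? D x z ×-dec Arc? D z y)
... | yes xy | _ =
  x ∷ y ∷ proj₁ P , path+arc⇒cycle D P xy , here refl , there (here refl)
  where
  P : PathAvoiding D ⊥ y x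
  P = strong ⊥ (subst (_< 2) (sym (∣⊥∣≡0 (2 * m + 1))) (s≤s z≤n)) y x ∉⊥ ∉⊥ (≢-sym x≢y)
... | no _ | yes (z , xz , zy) =
  x ∷ z ∷ y ∷ proj₁ P , path+arc⇒cycle D (arc+path⇒path D (x∈⁅x⁆ z) zy P) xz ,
  here refl , there (there (here refl))
  where
  P : PathAvoiding D ⁅ z ⁆ y x
  P = strong ⁅ z ⁆ (subst (_< 2) (sym (∣⁅x⁆∣≡1 z)) ≤-refl) y x
        (λ y∈⁅z⁆ → Arc⇒≢ D zy (sym (x∈⁅y⁆⇒x≡y z y∈⁅z⁆)))
        (λ x∈⁅z⁆ → Arc⇒≢ D xz (x∈⁅y⁆⇒x≡y z x∈⁅z⁆))
        (≢-sym x≢y)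
... | no ¬xy | no ¬xzy = ⊥-elim (m+m+2≰2*m+1 m (begin
  m + m + 2                                ≤⟨ +-monoˡ-≤ 2 (+-mono-≤ m≤outdeg m≤indeg) ⟩
  outdeg D x + indeg D y + 2               ≤⟨ no-short-path⇒outdeg+indeg+2≤n D x≢y ¬xy (λ z xzy → ¬xzy (z , xzy)) ⟩
  2 * m + 1                                ∎))
  where open Data.Nat.Properties.≤-Reasoning
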